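{- Let $G$ be a connected regular simple graph that has a simplicial vertex. Then $G$ is a complete graph.
   Context: A vertex $v$ of a simple graph $G$ is simplicial if its neighborhood $N_G(v)$ is a clique (induces a complete subgraph). -}

module Defs where

open import Data.Nat using (ℕ)
open import Data.Fin using (Fin)
open import Data.Product using (∃)
open import Data.List using (List; filter; length; allFin)
open import Relation.Nullary using (¬_; Dec)
open import Relation.Binary.PropositionalEquality using (_≡_)
open import Level using (0ℓ)
open import Data.Fin.Base using ()

record SimpleGraph (n : ℕ) : Set₁ where
  field
    Adj     : Fin n → Fin n → Set
    adj?    : ∀ u v → Dec (Adj u v)
    symm    : ∀ {u v} → Adj u v → Adj v u
    loopless : ∀ {v} → ¬ Adj v v

module _ {n : ℕ} (G : SimpleGraph n) where
  open SimpleGraph G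

  neighbours : Fin n → List (Fin n)
  neighbours v = filter (adj? v) (allFin n)

  degree : Fin n → ℕ
  degree v = length (neighbours v)

  Regular : Set
  Regular = ∃ λ d → ∀ v → degree v ≡ d

  data Walk : Fin n → Fin n → Set where
    nil  : ∀ {u} → Walk u u
    cons : ∀ {u w v} → Adj u w → Walk w v → Walk u v

  Connected : Set
  Connected = ∀ u v → Walk u v

  Simplicial : Fin n → Set
  Simplicial v = ∀ x y → Adj v x → Adj v y → ¬ x ≡ y → Adj x y

  Complete : Set
  Complete = ∀ u v → ¬ u ≡ v → Adj u v

{-# OPTIONS --safe #-}
-- Let v be simplicial and N[v] = {v} ∪ N(v) its closed neighbourhood. For a neighbour u of v,
-- N[v] ⊆ N[u] because N(v) is a clique containing u; by regularity both sets have d + 1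
-- elements, so N[u] = N[v]. Hence N[v] is closed under adjacency, so by connectedness it
-- contains every vertex, and N[v] is a clique.
module Submission where

open import Defs
open import Data.Nat using (ℕ; zero; suc; _≤_)
open import Data.Nat.Properties using (≤-reflexive; ≤⇒≯)
open import Data.Fin using (Fin; zero; suc; _≟_)
open import Data.Fin.Subset using (Subset; inside; outside; _∈_; _∉_; _⊆_; ⁅_⁆; _∪_; ∣_∣)
open import Data.Fin.Subset.Properties
  using (_∈?_; p⊂q⇒∣p∣<∣q∣; x∈⁅x⁆; x∈⁅y⁆⇒x≡y; x∈p∪q⁺; x∈p∪q⁻; ∪-identityˡ)
open import Data.List as List using (length; filter)
open import Data.Vec as Vec using (_∷_; here; there)
open import Data.Vec.Properties using (lookup∘tabulate; []=⇒lookup; lookup⇒[]=)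
open import Data.Product using (∃; _,_)
open import Data.Sum using (_⊎_; inj₁; inj₂)
open import Function using (_∘_; id)
open import Relation.Nullary using (yes; no; does; contradiction)
open import Relation.Unary using (Pred; Decidable)
open import Relation.Binary.PropositionalEquality using (_≡_; _≢_; refl; sym; trans; cong; module ≡-Reasoning)

∣⁅x⁆∪p∣≡1+∣p∣ : ∀ {n} {x : Fin n} {p : Subset n} → x ∉ p → ∣ ⁅ x ⁆ ∪ p ∣ ≡ suc ∣ p ∣
∣⁅x⁆∪p∣≡1+∣p∣ {x = zero}  {outside ∷ p} x∉p = cong (suc ∘ ∣_∣) (∪-identityˡ p)
∣⁅x⁆∪p∣≡1+∣p∣ {x = zero}  {inside ∷ p}  x∉p = contradiction here x∉p
∣⁅x⁆∪p∣≡1+∣p∣ {x = suc x} {outside ∷ p} x∉p = ∣⁅x⁆∪p∣≡1+∣p∣ (x∉p ∘ there)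
∣⁅x⁆∪p∣≡1+∣p∣ {x = suc x} {inside ∷ p}  x∉p = cong suc (∣⁅x⁆∪p∣≡1+∣p∣ (x∉p ∘ there))

p⊆q∧∣q∣≤∣p∣⇒q⊆p : ∀ {n} {p q : Subset n} → p ⊆ q → ∣ q ∣ ≤ ∣ p ∣ → q ⊆ p
p⊆q∧∣q∣≤∣p∣⇒q⊆p {p = p} p⊆q ∣q∣≤∣p∣ {x} x∈q with x ∈? p
... | yes x∈p = x∈p
... | no  x∉p = contradiction (p⊂q⇒∣p∣<∣q∣ (p⊆q , x , x∈q , x∉p)) (≤⇒≯ ∣q∣≤∣p∣)

module _ {n ℓ} {P : Pred (Fin n) ℓ} (P? : Decidable P) where

  toSubset : Subset n
  toSubset = Vec.tabulate (does ∘ P?)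

  ∈-toSubset⁺ : ∀ {x} → P x → x ∈ toSubset
  ∈-toSubset⁺ {x} px with P? x in eq
  ... | yes _ = lookup⇒[]= x toSubset (trans (lookup∘tabulate _ x) (cong does eq))
  ... | no ¬px = contradiction px ¬px

  ∈-toSubset⁻ : ∀ {x} → x ∈ toSubset → P x
  ∈-toSubset⁻ {x} x∈p with P? x | trans (sym (lookup∘tabulate (does ∘ P?) x)) ([]=⇒lookup x∈p)
  ... | yes px | _ = px
  ... | no _   | ()

  ∣toSubset∣≡length-filter : ∣ toSubset ∣ ≡ length (filter P? (List.allFin n))
  ∣toSubset∣≡length-filter = ∣tabulate∣≡length-filter-tabulate id
    where
    ∣tabulate∣≡length-filter-tabulate : ∀ {m} (f : Fin m → Fin n) →
      ∣ Vec.tabulate (does ∘ P? ∘ f) ∣ ≡ length (filter P? (List.tabulate f))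
    ∣tabulate∣≡length-filter-tabulate {zero}  f = refl
    ∣tabulate∣≡length-filter-tabulate {suc m} f with P? (f zero)
    ... | yes _ = cong suc (∣tabulate∣≡length-filter-tabulate (f ∘ suc))
    ... | no  _ = ∣tabulate∣≡length-filter-tabulate (f ∘ suc)

module Neighbourhoods {n} (G : SimpleGraph n) where
  open SimpleGraph G

  N : Fin n → Subset n
  N v = toSubset (adj? v)

  N[_] : Fin n → Subset n
  N[ v ] = ⁅ v ⁆ ∪ N v

  ∣N[v]∣≡1+degree : ∀ v → ∣ N[ v ] ∣ ≡ suc (degree G v)
  ∣N[v]∣≡1+degree v = trans (∣⁅x⁆∪p∣≡1+∣p∣ (loopless ∘ ∈-toSubset⁻ (adj? v)))
                            (cong suc (∣toSubset∣≡length-filter (adj? v)))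

  ∈N[]⁺ : ∀ {v x} → x ≡ v ⊎ Adj v x → x ∈ N[ v ]
  ∈N[]⁺ (inj₁ refl) = x∈p∪q⁺ (inj₁ (x∈⁅x⁆ _))
  ∈N[]⁺ (inj₂ vx)   = x∈p∪q⁺ (inj₂ (∈-toSubset⁺ (adj? _) vx))

  ∈N[]⁻ : ∀ {v x} → x ∈ N[ v ] → x ≡ v ⊎ Adj v x
  ∈N[]⁻ {v} x∈N[v] with x∈p∪q⁻ ⁅ v ⁆ (N v) x∈N[v]
  ... | inj₁ x∈⁅v⁆ = inj₁ (x∈⁅y⁆⇒x≡y v x∈⁅v⁆)
  ... | inj₂ x∈Nv  = inj₂ (∈-toSubset⁻ (adj? v) x∈Nv)

  Simplicial⇒N[v]⊆N[u] : ∀ {v u} → Simplicial G v → Adj v u → N[ v ] ⊆ N[ u ]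
  Simplicial⇒N[v]⊆N[u] {v} {u} simp vu x∈N[v] = ∈N[]⁺ (neighbour (∈N[]⁻ x∈N[v]))
    where
    neighbour : ∀ {x} → x ≡ v ⊎ Adj v x → x ≡ u ⊎ Adj u x
    neighbour (inj₁ refl) = inj₂ (symm vu)
    neighbour {x} (inj₂ vx) with x ≟ u
    ... | yes x≡u = inj₁ x≡u
    ... | no  x≢u = inj₂ (simp u x vu vx (x≢u ∘ sym))

  Simplicial∧Regular⇒N[u]⊆N[v] : ∀ {v u} → Regular G → Simplicial G v → u ∈ N[ v ] → N[ u ] ⊆ N[ v ]
  Simplicial∧Regular⇒N[u]⊆N[v] {v} {u} (d , regular) simp u∈N[v] with ∈N[]⁻ u∈N[v]
  ... | inj₁ refl = λ x∈N[v] → x∈N[v]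
  ... | inj₂ vu   = p⊆q∧∣q∣≤∣p∣⇒q⊆p (Simplicial⇒N[v]⊆N[u] simp vu) (≤-reflexive equalSize)
    where
    open ≡-Reasoning
    equalSize : ∣ N[ u ] ∣ ≡ ∣ N[ v ] ∣
    equalSize = begin
      ∣ N[ u ] ∣        ≡⟨ ∣N[v]∣≡1+degree u ⟩
      suc (degree G u)  ≡⟨ cong suc (trans (regular u) (sym (regular v))) ⟩
      suc (degree G v)  ≡⟨ ∣N[v]∣≡1+degree v ⟨
      ∣ N[ v ] ∣        ∎

  Simplicial⇒N[v]-clique : ∀ {v s t} → Simplicial G v → s ∈ N[ v ] → t ∈ N[ v ] → s ≢ t → Adj s t
  Simplicial⇒N[v]-clique simp s∈N[v] t∈N[v] s≢t with ∈N[]⁻ s∈N[v] | ∈N[]⁻ t∈N[v]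
  ... | inj₁ refl | inj₁ refl = contradiction refl s≢t
  ... | inj₁ refl | inj₂ vt   = vt
  ... | inj₂ vs   | inj₁ refl = symm vs
  ... | inj₂ vs   | inj₂ vt   = simp _ _ vs vt s≢t

  Walk-preserves : ∀ {ℓ} {P : Pred (Fin n) ℓ} → (∀ {x y} → Adj x y → P x → P y) →
                   ∀ {x y} → Walk G x y → P x → P y
  Walk-preserves step nil          px = px
  Walk-preserves step (cons xy wk) px = Walk-preserves step wk (step xy px)

lemma1 : (n : ℕ) (G : SimpleGraph n) → Connected G → Regular G → (∃ λ (v : Fin n) → Simplicial G v) → Complete G
lemma1 n G connected regular (v , simp) s t = Simplicial⇒N[v]-clique simp (reachable s) (reachable t)
  where
  open SimpleGraph G using (Adj)
  open Neighbourhoods G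

  N[v]-closed : ∀ {x y} → Adj x y → x ∈ N[ v ] → y ∈ N[ v ]
  N[v]-closed xy x∈N[v] = Simplicial∧Regular⇒N[u]⊆N[v] regular simp x∈N[v] (∈N[]⁺ (inj₂ xy))

  reachable : ∀ x → x ∈ N[ v ]
  reachable x = Walk-preserves N[v]-closed (connected v x) (∈N[]⁺ (inj₁ refl))
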